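{- Suppose all simple clopen games of length $\omega^2$ are determined. Then all $\sigma$-projective games of length $\omega$ are determined.
   Context: A game of length $\alpha$ with payoff $A\subseteq\omega^\alpha$: players I and II alternate playing natural numbers, producing $x\in\omega^\alpha$; I wins iff $x\in A$; it is determined if one player has a winning strategy. The $\sigma$-projective sets form the smallest pointclass (of subsets of the spaces $(\omega^\omega)^k$ with the product topology of discrete $\omega$) containing the open sets and closed under complements, countable unions, and projections. Identify $\omega^{\omega\cdot n}$ with $(\omega^\omega)^n$, $\omega^{\omega^2}$ with $(\omega^\omega)^\omega$, and $A\subseteq\omega^{\omega\cdot n}$ with $\{x\in\omega^{\omega^2}:x\restriction\omega\cdot n\in A\}$. Simple clopen games of length $\omega^2$ are generated as follows: (i) for each $n\in\omega$, a game decided after $\omega\cdot n$ moves whose payoff restricted to sequences of length $\omega\cdot n$ is clopen is simple clopen; (ii) if $n\in\omega$ and $G_i$ ($i\in\omega$) are simple clopen, then the game in which I and II alternate for $\omega\cdot n$ moves, then Player I plays some $i\in\omega$, and then play continues according to the rules of $G_i$ (keeping the first $\omega\cdot n$ moves, but not $i$) is simple clopen; (iii) the same as (ii) with Player II choosing $i$. -}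

module Defs where

open import Level using (0ℓ)
open import Data.Nat using (ℕ; zero; suc; _<_; _∸_)
open import Data.Fin using (Fin)
open import Data.Bool using (Bool; true; false; not; if_then_else_)
open import Data.List using (List; []; _∷_; _∷ʳ_; length)
open import Data.Product using (Σ; ∃; _×_)
open import Data.Sum using (_⊎_)
open import Data.Empty using (⊥)
open import Relation.Nullary using (¬_)
open import Relation.Binary.PropositionalEquality using (_≡_)
open import Function.Bundles using (_⇔_)
open import Data.Vec.Functional using (insertAt)

Baire : Set
Baire = ℕ → ℕ

Point : ℕ → Set
Point k = Fin k → Baire

IsOpen : (k : ℕ) → (Point k → Set) → Set
IsOpen k A = ∀ x → A x → ∃ λ m → ∀ y → (∀ (i : Fin k) j → j < m → y i j ≡ x i j) → A y

data SigmaProj : (k : ℕ) → (Point k → Set) → Set₁ where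
  open∈  : ∀ {k} {A : Point k → Set} → IsOpen k A → SigmaProj k A
  compl  : ∀ {k} {A : Point k → Set} → SigmaProj k A → SigmaProj k (λ x → ¬ A x)
  union  : ∀ {k} {A : ℕ → Point k → Set} → (∀ n → SigmaProj k (A n)) →
           SigmaProj k (λ x → ∃ λ n → A n x)
  proj   : ∀ {k} {A : Point (suc k) → Set} (i : Fin (suc k)) → SigmaProj (suc k) A →
           SigmaProj k (λ x → ∃ λ (y : Baire) → A (insertAt x i y))
  ext    : ∀ {k} {A B : Point k → Set} → SigmaProj k A → (∀ x → A x ⇔ B x) → SigmaProj k B

Strat : Set
Strat = List ℕ → ℕ

-- the play x ∈ ω^ω where I (using σ) moves at even and II (using τ) at odd positions
prefix : Strat → Strat → ℕ → List ℕ
turnI  : ℕ → Bool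
turnI zero    = true
turnI (suc k) = not (turnI k)

move : Strat → Strat → ℕ → List ℕ → ℕ
move σ τ k p = if turnI k then σ p else τ p

prefix σ τ zero    = []
prefix σ τ (suc k) = prefix σ τ k ∷ʳ move σ τ k (prefix σ τ k)

rowPlay : Strat → Strat → Baire
rowPlay σ τ k = move σ τ k (prefix σ τ k)

Determined : (Baire → Set) → Set
Determined A = (Σ Strat λ σ → ∀ τ → A (rowPlay σ τ))
             ⊎ (Σ Strat λ τ → ∀ σ → ¬ A (rowPlay σ τ))

-- Simple clopen games of length ω²
-- A play of length ω² is an element of ℕ → Baire (row n = moves ω·n .. ω·n+ω).

Play² : Set
Play² = ℕ → Baire

-- A ⊆ ω^{ω²} is (identified with) a clopen subset of ω^{ω·n}:
-- it depends only on the first n rows and is clopen there.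
OpenBelow : ℕ → (Play² → Set) → Set
OpenBelow n C = ∀ x → C x → ∃ λ m →
  ∀ y → (∀ i j → i < n → j < m → y i j ≡ x i j) → C y

ClopenBelow : ℕ → (Play² → Set) → Set
ClopenBelow n C =
  (∀ x y → (∀ i → i < n → x i ≡ y i) → C x → C y)
  × OpenBelow n C × OpenBelow n (λ x → ¬ C x)

data SimpleClopen : Set₁ where
  base     : (n : ℕ) (C : Play² → Set) → ClopenBelow n C → SimpleClopen
  chooseI  : (n : ℕ) → (ℕ → SimpleClopen) → SimpleClopen
  chooseII : (n : ℕ) → (ℕ → SimpleClopen) → SimpleClopen

-- Positions: the completed rows so far (stage = their number), the list of
-- choices i made so far, and (for row moves) the current partial row.
record Strat² : Set where
  field
    rowMove    : List Baire → List ℕ → List ℕ → ℕ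
    choiceMove : List Baire → List ℕ → ℕ
open Strat² public

module Run (σ τ : Strat²) where
  nextRow : List Baire → List ℕ → Baire
  nextRow rs cs = rowPlay (rowMove σ rs cs) (rowMove τ rs cs)

  playRows : ℕ → List Baire → List ℕ → List Baire
  playRows zero    rs cs = rs
  playRows (suc k) rs cs = playRows k (rs ∷ʳ nextRow rs cs) cs

  catchUp : ℕ → List Baire → List ℕ → List Baire
  catchUp n rs cs = playRows (n ∸ length rs) rs cs

  pad : List Baire → Play²
  pad []       _       = λ _ → 0
  pad (r ∷ rs) zero    = r
  pad (r ∷ rs) (suc i) = pad rs i

  IWins : SimpleClopen → List Baire → List ℕ → Set
  IWins (base n C _)   rs cs = C (pad (catchUp n rs cs))
  IWins (chooseI n G)  rs cs =
    IWins (G (choiceMove σ (catchUp n rs cs) cs)) (catchUp n rs cs)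
          (cs ∷ʳ choiceMove σ (catchUp n rs cs) cs)
  IWins (chooseII n G) rs cs =
    IWins (G (choiceMove τ (catchUp n rs cs) cs)) (catchUp n rs cs)
          (cs ∷ʳ choiceMove τ (catchUp n rs cs) cs)

IWins² : Strat² → Strat² → SimpleClopen → Set
IWins² σ τ G = Run.IWins σ τ G [] []

Determined² : SimpleClopen → Set
Determined² G = (Σ Strat² λ σ → ∀ τ → IWins² σ τ G)
              ⊎ (Σ Strat² λ τ → ∀ σ → ¬ IWins² σ τ G)

-- Every σ-projective A ⊆ (ω^ω)^k, its point read continuously off the first d rows of a play of
-- length ω², comes with two simple clopen games: from a position with d rows played, I wins the
-- first exactly when the point lies in A and the second exactly when it does not, each side by a
-- single strategy uniform over all such positions.  An open set is a union of neighbourhoods, one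
-- of which I names before a clopen check; for a union I names the index, for the complement of a
-- union II does; for a projection one more row is played, in which I writes the witness on his
-- moves (or II a counter-witness on hers) and the new coordinate is read off those moves;
-- complements swap the two games.  Uniformity is what lets strategies be spliced at the stage of
-- a choice, excluded middle only picks the witnesses.  Finally, if "play row 0, then the game for
-- A" is determined, the winner's strategy for row 0 wins the game on A: an opponent reaching a
-- losing row is beaten by switching to the uniform strategy of the second game.

module Submission where

open import Defs
open import Data.Fin using (Fin)
open import Axiom.ExcludedMiddle using (ExcludedMiddle)

module _ where
  open import Data.Bool using (true; false; not)
  open import Data.Fin using () renaming (zero to fzero; suc to fsuc)
  open import Data.List using (List; []; _∷_; _∷ʳ_; length)
  open import Data.List.Properties using (length-++)
  open import Data.Maybe using (Maybe; just; nothing; maybe′)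
  open import Data.Nat using (ℕ; zero; suc; _+_; _<_; _∸_; ⌊_/2⌋; z≤n; s≤s)
  open import Data.Nat.Properties
    using (+-comm; n∸n≡0; m+n∸n≡m; n<1+n; m<n⇒m<1+n; <-≤-trans; m≤m+n; m≤n+m)
  open import Data.Product using (Σ; ∃; _×_; _,_; proj₁; proj₂)
  open import Data.Sum using (inj₁; inj₂)
  open import Function.Base using (_∘_; id)
  open import Function.Bundles using (_⇔_; Equivalence; mk⇔)
  open import Function.Properties.Equivalence using () renaming (sym to ⇔-sym; trans to ⇔-trans)
  open import Function.Related.TypeIsomorphisms using (¬-cong-⇔)
  open import Relation.Nullary using (¬_; Dec; yes; no; contradiction)
  open import Relation.Nullary.Decidable using (decidable-stable)
  open import Relation.Nullary.Negation using (∀¬⟶¬∃; ¬∃⟶∀¬)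
  open import Relation.Binary.PropositionalEquality
    using (_≡_; _≗_; refl; sym; trans; cong; cong₂; cong-app; subst; subst₂; module ≡-Reasoning)
  open ≡-Reasoning
  open import Data.Vec.Functional using (insertAt)

  length-∷ʳ : {A : Set} (xs : List A) (x : A) → length (xs ∷ʳ x) ≡ suc (length xs)
  length-∷ʳ xs x = trans (length-++ xs) (+-comm (length xs) 1)

  length-∷ʳ-suc : {A : Set} (xs : List A) (x : A) {n : ℕ} → length xs ≡ n → length (xs ∷ʳ x) ≡ suc n
  length-∷ʳ-suc xs x refl = length-∷ʳ xs x

  _‼_ : {A : Set} → List A → ℕ → Maybe A
  []       ‼ _     = nothing
  (x ∷ xs) ‼ zero  = just x
  (x ∷ xs) ‼ suc i = xs ‼ i

  ‼-length : {A : Set} (xs : List A) → xs ‼ length xs ≡ nothing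
  ‼-length []       = refl
  ‼-length (x ∷ xs) = ‼-length xs

  ∷ʳ-‼-length : {A : Set} (xs : List A) (x : A) → (xs ∷ʳ x) ‼ length xs ≡ just x
  ∷ʳ-‼-length []       x = refl
  ∷ʳ-‼-length (y ∷ xs) x = ∷ʳ-‼-length xs x

  ‼-∷ʳ : {A : Set} (xs : List A) (x : A) {i : ℕ} {y : A} →
         xs ‼ i ≡ just y → (xs ∷ʳ x) ‼ i ≡ just y
  ‼-∷ʳ (z ∷ xs) x {zero}  eq = eq
  ‼-∷ʳ (z ∷ xs) x {suc i} eq = ‼-∷ʳ xs x eq

  double : ℕ → ℕ
  double zero    = zero
  double (suc n) = suc (suc (double n))

  ⌊double/2⌋ : ∀ n → ⌊ double n /2⌋ ≡ n
  ⌊double/2⌋ zero    = refl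
  ⌊double/2⌋ (suc n) = cong suc (⌊double/2⌋ n)

  ⌊1+double/2⌋ : ∀ n → ⌊ suc (double n) /2⌋ ≡ n
  ⌊1+double/2⌋ zero    = refl
  ⌊1+double/2⌋ (suc n) = cong suc (⌊1+double/2⌋ n)

  turnI-double : ∀ n → turnI (double n) ≡ true
  turnI-double zero    = refl
  turnI-double (suc n) rewrite turnI-double n = refl

  double-mono : ∀ {j m} → j < m → double j < double m
  double-mono {zero}  {suc m} _         = s≤s z≤n
  double-mono {suc j} {suc m} (s≤s j<m) = s≤s (s≤s (double-mono j<m))

  1+double-mono : ∀ {j m} → j < m → suc (double j) < double m
  1+double-mono {zero}  {suc m} _         = s≤s (s≤s z≤n)
  1+double-mono {suc j} {suc m} (s≤s j<m) = s≤s (s≤s (1+double-mono j<m))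

  length-prefix : ∀ σ τ k → length (prefix σ τ k) ≡ k
  length-prefix σ τ zero    = refl
  length-prefix σ τ (suc k) =
    trans (length-∷ʳ (prefix σ τ k) _) (cong suc (length-prefix σ τ k))

  -- Makes its j-th own move in the row equal to y j, whichever player uses it.
  playing : Baire → Strat
  playing y p = y ⌊ length p /2⌋

  rowPlay-I : ∀ σ τ k → turnI k ≡ true → rowPlay σ τ k ≡ σ (prefix σ τ k)
  rowPlay-I σ τ k eq rewrite eq = refl

  rowPlay-II : ∀ σ τ k → turnI k ≡ false → rowPlay σ τ k ≡ τ (prefix σ τ k)
  rowPlay-II σ τ k eq rewrite eq = refl

  rowPlay-even : ∀ y τ j → rowPlay (playing y) τ (double j) ≡ y j
  rowPlay-even y τ j = begin
    rowPlay (playing y) τ (double j)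
      ≡⟨ rowPlay-I (playing y) τ (double j) (turnI-double j) ⟩
    y ⌊ length (prefix (playing y) τ (double j)) /2⌋
      ≡⟨ cong (λ n → y ⌊ n /2⌋) (length-prefix (playing y) τ (double j)) ⟩
    y ⌊ double j /2⌋
      ≡⟨ cong y (⌊double/2⌋ j) ⟩
    y j ∎

  rowPlay-odd : ∀ y σ j → rowPlay σ (playing y) (suc (double j)) ≡ y j
  rowPlay-odd y σ j = begin
    rowPlay σ (playing y) (suc (double j))
      ≡⟨ rowPlay-II σ (playing y) (suc (double j)) (cong not (turnI-double j)) ⟩
    y ⌊ length (prefix σ (playing y) (suc (double j))) /2⌋
      ≡⟨ cong (λ n → y ⌊ n /2⌋) (length-prefix σ (playing y) (suc (double j))) ⟩
    y ⌊ suc (double j) /2⌋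
      ≡⟨ cong y (⌊1+double/2⌋ j) ⟩
    y j ∎

  idle : Strat²
  idle = record { rowMove = λ _ _ _ → 0 ; choiceMove = λ _ _ → 0 }

  padRows : List Baire → Play²
  padRows = Run.pad idle idle

  pad-irrelevant : ∀ σ τ σ′ τ′ rs i → Run.pad σ τ rs i ≡ Run.pad σ′ τ′ rs i
  pad-irrelevant σ τ σ′ τ′ []       i       = refl
  pad-irrelevant σ τ σ′ τ′ (r ∷ rs) zero    = refl
  pad-irrelevant σ τ σ′ τ′ (r ∷ rs) (suc i) = pad-irrelevant σ τ σ′ τ′ rs i

  padRows-∷ʳ-< : ∀ rs r {i} → i < length rs → padRows (rs ∷ʳ r) i ≡ padRows rs i
  padRows-∷ʳ-< (r′ ∷ rs) r {zero}  _         = refl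
  padRows-∷ʳ-< (r′ ∷ rs) r {suc i} (s≤s i<n) = padRows-∷ʳ-< rs r i<n

  padRows-∷ʳ-length : ∀ rs r → padRows (rs ∷ʳ r) (length rs) ≡ r
  padRows-∷ʳ-length []        r = refl
  padRows-∷ʳ-length (r′ ∷ rs) r = padRows-∷ʳ-length rs r

  afterRow : ℕ → SimpleClopen → SimpleClopen
  afterRow d G = chooseI (suc d) (λ _ → G)

  module _ (σ τ : Strat²) where
    open Run σ τ

    catchUp-now : ∀ {n} rs cs → length rs ≡ n → catchUp n rs cs ≡ rs
    catchUp-now rs cs refl = cong (λ k → playRows k rs cs) (n∸n≡0 (length rs))

    catchUp-next : ∀ {n} rs cs → length rs ≡ n → catchUp (suc n) rs cs ≡ rs ∷ʳ nextRow rs cs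
    catchUp-next rs cs refl = cong (λ k → playRows k rs cs) (m+n∸n≡m 1 (length rs))

    IWins-chooseI : ∀ {n F} rs cs {L} → catchUp n rs cs ≡ L →
      IWins (chooseI n F) rs cs ≡ IWins (F (choiceMove σ L cs)) L (cs ∷ʳ choiceMove σ L cs)
    IWins-chooseI rs cs refl = refl

    IWins-chooseII : ∀ {n F} rs cs {L} → catchUp n rs cs ≡ L →
      IWins (chooseII n F) rs cs ≡ IWins (F (choiceMove τ L cs)) L (cs ∷ʳ choiceMove τ L cs)
    IWins-chooseII rs cs refl = refl

    IWins-base : ∀ {n C h} rs cs {L} → catchUp n rs cs ≡ L → IWins (base n C h) rs cs ≡ C (pad L)
    IWins-base rs cs refl = refl

    IWins-afterRow : ∀ {d G} rs cs → length rs ≡ d →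
      let L = rs ∷ʳ nextRow rs cs in
      IWins (afterRow d G) rs cs ≡ IWins G L (cs ∷ʳ choiceMove σ L cs)
    IWins-afterRow {d} {G} rs cs len = IWins-chooseI {suc d} {λ _ → G} rs cs (catchUp-next rs cs len)

  record Persistent (Q : List Baire → List ℕ → Set) : Set where
    field
      ∷ʳ-row    : ∀ {rs cs} r → Q rs cs → Q (rs ∷ʳ r) cs
      ∷ʳ-choice : ∀ {rs cs} c → Q rs cs → Q rs (cs ∷ʳ c)
  open Persistent

  AgreeOn : (List Baire → List ℕ → Set) → Strat² → Strat² → Set
  AgreeOn Q σ σ′ = ∀ rs cs → Q rs cs →
    rowMove σ rs cs ≡ rowMove σ′ rs cs × choiceMove σ rs cs ≡ choiceMove σ′ rs cs

  AgreeOn-sym : ∀ {Q σ σ′} → AgreeOn Q σ σ′ → AgreeOn Q σ′ σ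
  AgreeOn-sym σ≈σ′ rs cs q = sym (proj₁ (σ≈σ′ rs cs q)) , sym (proj₂ (σ≈σ′ rs cs q))

  module _ {Q} (Q-persistent : Persistent Q) {σ σ′ τ τ′ : Strat²}
           (σ≈σ′ : AgreeOn Q σ σ′) (τ≈τ′ : AgreeOn Q τ τ′) where

    playRows-agree : ∀ k {rs cs} → Q rs cs →
      Run.playRows σ τ k rs cs ≡ Run.playRows σ′ τ′ k rs cs × Q (Run.playRows σ τ k rs cs) cs
    playRows-agree zero    q = refl , q
    playRows-agree (suc k) {rs} {cs} q
      with playRows-agree k (∷ʳ-row Q-persistent (Run.nextRow σ τ rs cs) q)
    ... | L≡L′ , q′ = trans L≡L′ (cong (λ r → Run.playRows σ′ τ′ k (rs ∷ʳ r) cs) nextRow≡) , q′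
      where
      nextRow≡ : Run.nextRow σ τ rs cs ≡ Run.nextRow σ′ τ′ rs cs
      nextRow≡ = cong₂ rowPlay (proj₁ (σ≈σ′ rs cs q)) (proj₁ (τ≈τ′ rs cs q))

    choiceMove-agree : ∀ {ρ ρ′} → AgreeOn Q ρ ρ′ → ∀ {L L′ cs} → Q L cs → L ≡ L′ →
      choiceMove ρ L cs ≡ choiceMove ρ′ L′ cs
    choiceMove-agree ρ≈ρ′ {L} {cs = cs} q refl = proj₂ (ρ≈ρ′ L cs q)

    IWins-agree : ∀ G {rs cs} → Q rs cs → Run.IWins σ τ G rs cs → Run.IWins σ′ τ′ G rs cs
    IWins-agree (base n C (C-local , _)) {rs} {cs} q w with playRows-agree (n ∸ length rs) q
    ... | L≡L′ , _ = subst (λ L → C (Run.pad σ′ τ′ L)) L≡L′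
                       (C-local _ _ (λ i _ → pad-irrelevant σ τ σ′ τ′ (Run.catchUp σ τ n rs cs) i) w)
    IWins-agree (chooseI n F) {rs} {cs} q w with playRows-agree (n ∸ length rs) q
    ... | L≡L′ , qL = subst₂ (λ L c → Run.IWins σ′ τ′ (F c) L (cs ∷ʳ c)) L≡L′
                        (choiceMove-agree σ≈σ′ qL L≡L′)
                        (IWins-agree (F _) (∷ʳ-choice Q-persistent _ qL) w)
    IWins-agree (chooseII n F) {rs} {cs} q w with playRows-agree (n ∸ length rs) q
    ... | L≡L′ , qL = subst₂ (λ L c → Run.IWins σ′ τ′ (F c) L (cs ∷ʳ c)) L≡L′
                        (choiceMove-agree τ≈τ′ qL L≡L′)
                        (IWins-agree (F _) (∷ʳ-choice Q-persistent _ qL) w)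

  IWins-agreeI : ∀ {Q σ σ′ τ} → Persistent Q → AgreeOn Q σ σ′ → ∀ G rs cs → Q rs cs →
    Run.IWins σ τ G rs cs → Run.IWins σ′ τ G rs cs
  IWins-agreeI Q-persistent σ≈σ′ G _ _ = IWins-agree Q-persistent σ≈σ′ (λ _ _ _ → refl , refl) G

  IWins-agreeII : ∀ {Q σ τ τ′} → Persistent Q → AgreeOn Q τ τ′ → ∀ G rs cs → Q rs cs →
    Run.IWins σ τ G rs cs → Run.IWins σ τ′ G rs cs
  IWins-agreeII Q-persistent τ≈τ′ G _ _ = IWins-agree Q-persistent (λ _ _ _ → refl , refl) τ≈τ′ G

  rowThen : ℕ → (List Baire → List ℕ → Strat) → Strat² → Strat²
  rowThen d s σ = record
    { rowMove    = λ rs cs → maybe′ (λ _ → rowMove σ rs cs) (s rs cs) (rs ‼ d)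
    ; choiceMove = choiceMove σ }

  RowPlayed : ℕ → List Baire → List ℕ → Set
  RowPlayed d rs _ = ∃ λ r → rs ‼ d ≡ just r

  rowPlayed-persistent : ∀ d → Persistent (RowPlayed d)
  rowPlayed-persistent d = record
    { ∷ʳ-row    = λ {rs} r (r′ , played) → r′ , ‼-∷ʳ rs r played
    ; ∷ʳ-choice = λ _ played → played }

  rowPlayed-∷ʳ : ∀ {d} rs r cs → length rs ≡ d → RowPlayed d (rs ∷ʳ r) cs
  rowPlayed-∷ʳ rs r cs refl = r , ∷ʳ-‼-length rs r

  rowThen-agrees : ∀ {d s σ} → AgreeOn (RowPlayed d) (rowThen d s σ) σ
  rowThen-agrees _ _ (_ , played) rewrite played = refl , refl

  rowThen-now : ∀ {d s σ} rs cs → length rs ≡ d → rowMove (rowThen d s σ) rs cs ≡ s rs cs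
  rowThen-now rs _ refl rewrite ‼-length rs = refl

  choiceThen : ℕ → (List Baire → ℕ) → (ℕ → Strat²) → Strat²
  choiceThen e pick σs = record
    { rowMove    = λ rs cs → maybe′ (λ n → rowMove (σs n) rs cs) (λ _ → 0) (cs ‼ e)
    ; choiceMove = λ rs cs → maybe′ (λ n → choiceMove (σs n) rs cs) (pick rs) (cs ‼ e) }

  ChoiceMade : ℕ → ℕ → List Baire → List ℕ → Set
  ChoiceMade e n _ cs = cs ‼ e ≡ just n

  choiceMade-persistent : ∀ e n → Persistent (ChoiceMade e n)
  choiceMade-persistent e n = record
    { ∷ʳ-row    = λ _ made → made
    ; ∷ʳ-choice = λ {_} {cs} c made → ‼-∷ʳ cs c made }

  choiceMade-∷ʳ : ∀ {e} rs cs c → length cs ≡ e → ChoiceMade e c rs (cs ∷ʳ c)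
  choiceMade-∷ʳ _ cs c refl = ∷ʳ-‼-length cs c

  choiceThen-agrees : ∀ {e n pick σs} → AgreeOn (ChoiceMade e n) (choiceThen e pick σs) (σs n)
  choiceThen-agrees _ _ made rewrite made = refl , refl

  choiceThen-now : ∀ {e pick σs} rs cs → length cs ≡ e → choiceMove (choiceThen e pick σs) rs cs ≡ pick rs
  choiceThen-now _ cs refl rewrite ‼-length cs = refl

  WinningI : SimpleClopen → ℕ → ℕ → (List Baire → Set) → Strat² → Set
  WinningI G d e P σ = ∀ rs cs → length rs ≡ d → length cs ≡ e → P rs →
    ∀ τ → Run.IWins σ τ G rs cs

  WinningII : SimpleClopen → ℕ → ℕ → (List Baire → Set) → Strat² → Set
  WinningII G d e P τ = ∀ rs cs → length rs ≡ d → length cs ≡ e → ¬ P rs →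
    ∀ σ → ¬ Run.IWins σ τ G rs cs

  record Decides (G : SimpleClopen) (d e : ℕ) (P : List Baire → Set) : Set where
    field
      strategyI  : Strat²
      winningI   : WinningI G d e P strategyI
      strategyII : Strat²
      winningII  : WinningII G d e P strategyII
  open Decides

  Decider : ℕ → ℕ → (List Baire → Set) → Set₁
  Decider d e P = Σ SimpleClopen λ G → Decides G d e P

  Decider-resp : ∀ {d e P P′} → (∀ {rs} → P rs ⇔ P′ rs) → Decider d e P → Decider d e P′
  Decider-resp P⇔P′ (G , D) = G , record
    { strategyI  = strategyI D
    ; winningI   = λ rs cs len len′ p′ → winningI D rs cs len len′ (Equivalence.from P⇔P′ p′)
    ; strategyII = strategyII D
    ; winningII  = λ rs cs len len′ ¬p′ → winningII D rs cs len len′ (¬p′ ∘ Equivalence.to P⇔P′) }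

  IWins-base-now : ∀ σ τ {d C} (C-clopen : ClopenBelow d C) rs cs → length rs ≡ d →
    Run.IWins σ τ (base d C C-clopen) rs cs ⇔ C (padRows rs)
  IWins-base-now σ τ {C = C} C-clopen@(C-local , _) rs cs len =
    subst (_⇔ C (padRows rs)) (sym (IWins-base σ τ {C = C} {C-clopen} rs cs (catchUp-now σ τ rs cs len)))
      (mk⇔ (C-local _ _ λ i _ → pad-irrelevant σ τ idle idle rs i)
           (C-local _ _ λ i _ → pad-irrelevant idle idle σ τ rs i))

  base-decides : ∀ {d e C} (C-clopen : ClopenBelow d C) → Decides (base d C C-clopen) d e (C ∘ padRows)
  base-decides C-clopen = record
    { strategyI  = idle
    ; winningI   = λ rs cs len _ c τ → Equivalence.from (IWins-base-now idle τ C-clopen rs cs len) c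
    ; strategyII = idle
    ; winningII  = λ rs cs len _ ¬c σ w → ¬c (Equivalence.to (IWins-base-now σ idle C-clopen rs cs len) w) }

  insertAt-cong : ∀ {k} (R : Baire → Baire → Set) {u v : Point k} {a b : Baire} (i : Fin (suc k)) →
    (∀ f → R (u f) (v f)) → R a b → ∀ f → R (insertAt u i a f) (insertAt v i b f)
  insertAt-cong           R fzero    uRv aRb fzero    = aRb
  insertAt-cong           R fzero    uRv aRb (fsuc f) = uRv f
  insertAt-cong {suc k} R (fsuc i) uRv aRb fzero    = uRv fzero
  insertAt-cong {suc k} R (fsuc i) uRv aRb (fsuc f) = insertAt-cong R i (uRv ∘ fsuc) aRb f

  sigmaProj-resp : ∀ {k A} → SigmaProj k A → ∀ {x y : Point k} → (∀ f → x f ≗ y f) → A x → A y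
  sigmaProj-resp (open∈ A-open)  x≗y a      = proj₂ (A-open _ a) _ λ f j _ → sym (x≗y f j)
  sigmaProj-resp (compl A-sp)    x≗y ¬a a′  = ¬a (sigmaProj-resp A-sp (λ f j → sym (x≗y f j)) a′)
  sigmaProj-resp (union A-sp)    x≗y (n , a) = n , sigmaProj-resp (A-sp n) x≗y a
  sigmaProj-resp (proj i A-sp)   x≗y (z , a) =
    z , sigmaProj-resp A-sp (insertAt-cong (λ u v → u ≗ v) i x≗y (λ _ → refl)) a
  sigmaProj-resp (ext A-sp A⇔B)  x≗y b      =
    Equivalence.to (A⇔B _) (sigmaProj-resp A-sp x≗y (Equivalence.from (A⇔B _) b))

  record Reader (k d : ℕ) : Set where
    field
      read            : Play² → Point k
      read-local      : ∀ x y → (∀ i → i < d → x i ≗ y i) → ∀ f → read x f ≗ read y f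
      read-continuous : ∀ m → ∃ λ m′ → ∀ x y → (∀ i j → i < d → j < m′ → y i j ≡ x i j) →
                          ∀ f j → j < m → read y f j ≡ read x f j
  open Reader

  readRows : ∀ {k d} → Reader k d → List Baire → Point k
  readRows Rd rs = read Rd (padRows rs)

  firstRow : Reader 1 1
  firstRow = record
    { read            = λ x _ → x 0
    ; read-local      = λ x y x≗y _ → x≗y 0 (s≤s z≤n)
    ; read-continuous = λ m → m , λ x y y≈x _ j j<m → y≈x 0 j (s≤s z≤n) j<m }

  insertRow : ∀ {k d} → Reader k d → Fin (suc k) → (g bound : ℕ → ℕ) →
    (∀ {j m} → j < m → g j < bound m) → Reader (suc k) (suc d)
  insertRow {d = d} Rd i g bound g<bound = record
    { read            = λ x → insertAt (read Rd x) i (λ j → x d (g j))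
    ; read-local      = λ x y x≗y f j →
        insertAt-cong (λ a b → a j ≡ b j) i
          (λ f′ → read-local Rd x y (λ i′ i′<d → x≗y i′ (m<n⇒m<1+n i′<d)) f′ j)
          (x≗y d (n<1+n d) (g j)) f
    ; read-continuous = λ m →
        let m′ , close⇒ = read-continuous Rd m in
        m′ + bound m , λ x y y≈x f j j<m →
          insertAt-cong (λ a b → a j ≡ b j) i
            (λ f′ → close⇒ x y (λ i′ j′ i′<d j′<m′ → y≈x i′ j′ (m<n⇒m<1+n i′<d)
                                   (<-≤-trans j′<m′ (m≤m+n m′ (bound m)))) f′ j j<m)
            (y≈x d (g j) (n<1+n d) (<-≤-trans (g<bound j<m) (m≤n+m (bound m) m′))) f }

  insertRow-⇔ : ∀ {k d A} → SigmaProj (suc k) A → (Rd : Reader k d) (i : Fin (suc k)) (g bound : ℕ → ℕ)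
    (g<bound : ∀ {j m} → j < m → g j < bound m) → ∀ rs r y → length rs ≡ d → (∀ j → r (g j) ≡ y j) →
    A (readRows (insertRow Rd i g bound g<bound) (rs ∷ʳ r)) ⇔ A (insertAt (readRows Rd rs) i y)
  insertRow-⇔ A-sp Rd i g bound g<bound rs r y refl r∘g≗y =
    mk⇔ (sigmaProj-resp A-sp reads) (sigmaProj-resp A-sp λ f j → sym (reads f j))
    where
    reads : ∀ f → readRows (insertRow Rd i g bound g<bound) (rs ∷ʳ r) f ≗ insertAt (readRows Rd rs) i _ f
    reads f j = insertAt-cong (λ a b → a j ≡ b j) i
      (λ f′ → read-local Rd _ _ (λ i′ i′<n → cong-app (padRows-∷ʳ-< rs r i′<n)) f′ j)
      (trans (cong-app (padRows-∷ʳ-length rs r) (g j)) (r∘g≗y j)) f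

  Neighbourhood : ∀ {k d} → Reader k d → (Point k → Set) → ℕ → Play² → Set
  Neighbourhood Rd A m x = ∀ z → (∀ f j → j < m → z f j ≡ read Rd x f j) → A z

  neighbourhood-clopen : ∀ {k d} (Rd : Reader k d) A m → ClopenBelow d (Neighbourhood Rd A m)
  neighbourhood-clopen {d = d} Rd A m = local , open-N , open-¬N
    where
    m′ = proj₁ (read-continuous Rd m)
    close⇒ = proj₂ (read-continuous Rd m)
    N = Neighbourhood Rd A m

    local : ∀ x y → (∀ i → i < d → x i ≡ y i) → N x → N y
    local x y x≡y Nx z z≈y = Nx z λ f j j<m →
      trans (z≈y f j j<m) (sym (read-local Rd x y (λ i i<d → cong-app (x≡y i i<d)) f j))

    open-N : OpenBelow d N
    open-N x Nx = m′ , λ y y≈x z z≈y → Nx z λ f j j<m → trans (z≈y f j j<m) (close⇒ x y y≈x f j j<m)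

    open-¬N : OpenBelow d (¬_ ∘ N)
    open-¬N x ¬Nx = m′ , λ y y≈x Ny → ¬Nx λ z z≈x →
      Ny z λ f j j<m → trans (z≈x f j j<m) (sym (close⇒ x y y≈x f j j<m))

  open⇔∃neighbourhood : ∀ {k d A} → IsOpen k A → (Rd : Reader k d) →
    ∀ x → A (read Rd x) ⇔ ∃ λ m → Neighbourhood Rd A m x
  open⇔∃neighbourhood A-open Rd x =
    mk⇔ (A-open (read Rd x)) λ (m , N) → N (read Rd x) λ _ _ _ → refl

  ∀¬⇔¬∃ : {W : Set} {B : W → Set} → (∀ w → ¬ B w) ⇔ (¬ ∃ B)
  ∀¬⇔¬∃ = mk⇔ ∀¬⟶¬∃ ¬∃⟶∀¬

  module _ (lem : {P : Set} → Dec P) where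

    dne : {P : Set} → ¬ ¬ P → P
    dne = decidable-stable lem

    ¬∀⇒∃¬ : {W : Set} {B : W → Set} → ¬ (∀ w → B w) → ∃ λ w → ¬ B w
    ¬∀⇒∃¬ ¬∀ = dne λ ∄ → ¬∀ λ w → dne λ ¬b → ∄ (w , ¬b)

    ε : {W : Set} → W → (W → Set) → W
    ε {W} w₀ B with lem {Σ W B}
    ... | yes (w , _) = w
    ... | no _        = w₀

    ε-spec : {W : Set} {w₀ : W} (B : W → Set) {w : W} → B w → B (ε w₀ B)
    ε-spec {W} B b with lem {Σ W B}
    ... | yes (_ , b′) = b′
    ... | no ∄         = contradiction (_ , b) ∄

    ClopenBelow-¬ : ∀ {n C} → ClopenBelow n C → ClopenBelow n (¬_ ∘ C)
    ClopenBelow-¬ (local , open-C , open-¬C) =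
        (λ x y x≡y ¬Cx Cy → ¬Cx (local y x (λ i i<n → sym (x≡y i i<n)) Cy))
      , open-¬C
      , λ x ¬¬Cx → let m , near⇒C = open-C x (dne ¬¬Cx) in m , λ y y≈x ¬Cy → ¬Cy (near⇒C y y≈x)

    chooseI-decides : ∀ {d e F} {P : ℕ → List Baire → Set} →
      (∀ n → Decides (F n) d (suc e) (P n)) → Decides (chooseI d F) d e (λ rs → ∃ λ n → P n rs)
    chooseI-decides {d} {e} {F} {P} D = record
      { strategyI = σ ; winningI = winI ; strategyII = τ ; winningII = winII }
      where
      σ τ : Strat²
      σ = choiceThen e (λ rs → ε 0 (λ n → P n rs)) (strategyI ∘ D)
      τ = choiceThen e (λ _ → 0) (strategyII ∘ D)

      σ-agrees : ∀ n → AgreeOn (ChoiceMade e n) (strategyI (D n)) σ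
      σ-agrees n = AgreeOn-sym choiceThen-agrees

      τ-agrees : ∀ n → AgreeOn (ChoiceMade e n) τ (strategyII (D n))
      τ-agrees n = choiceThen-agrees

      σ-chooses : ∀ rs cs → length cs ≡ e → choiceMove σ rs cs ≡ ε 0 (λ n → P n rs)
      σ-chooses = choiceThen-now {σs = strategyI ∘ D}

      winI : WinningI (chooseI d F) d e (λ rs → ∃ λ n → P n rs) σ
      winI rs cs len len′ (n , p) τ′ =
        subst id (sym (IWins-chooseI σ τ′ {F = F} rs cs (catchUp-now σ τ′ rs cs len)))
          (IWins-agreeI (choiceMade-persistent e c) (σ-agrees c) (F c) rs (cs ∷ʳ c)
            (choiceMade-∷ʳ rs cs c len′)
            (winningI (D c) rs (cs ∷ʳ c) len (length-∷ʳ-suc cs c len′) c-spec τ′))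
        where
        c = choiceMove σ rs cs
        c-spec : P c rs
        c-spec = subst (λ m → P m rs) (sym (σ-chooses rs cs len′)) (ε-spec (λ n → P n rs) p)

      winII : WinningII (chooseI d F) d e (λ rs → ∃ λ n → P n rs) τ
      winII rs cs len len′ ∄ σ′ w =
        winningII (D c) rs (cs ∷ʳ c) len (length-∷ʳ-suc cs c len′) (λ p → ∄ (c , p)) σ′
          (IWins-agreeII (choiceMade-persistent e c) (τ-agrees c) (F c) rs (cs ∷ʳ c)
            (choiceMade-∷ʳ rs cs c len′)
            (subst id (IWins-chooseI σ′ τ {F = F} rs cs (catchUp-now σ′ τ rs cs len)) w))
        where c = choiceMove σ′ rs cs

    chooseII-decides : ∀ {d e F} {P : ℕ → List Baire → Set} →
      (∀ n → Decides (F n) d (suc e) (P n)) → Decides (chooseII d F) d e (λ rs → ∀ n → P n rs)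
    chooseII-decides {d} {e} {F} {P} D = record
      { strategyI = σ ; winningI = winI ; strategyII = τ ; winningII = winII }
      where
      σ τ : Strat²
      σ = choiceThen e (λ _ → 0) (strategyI ∘ D)
      τ = choiceThen e (λ rs → ε 0 (λ n → ¬ P n rs)) (strategyII ∘ D)

      σ-agrees : ∀ n → AgreeOn (ChoiceMade e n) (strategyI (D n)) σ
      σ-agrees n = AgreeOn-sym choiceThen-agrees

      τ-agrees : ∀ n → AgreeOn (ChoiceMade e n) τ (strategyII (D n))
      τ-agrees n = choiceThen-agrees

      τ-chooses : ∀ rs cs → length cs ≡ e → choiceMove τ rs cs ≡ ε 0 (λ n → ¬ P n rs)
      τ-chooses = choiceThen-now {σs = strategyII ∘ D}

      winI : WinningI (chooseII d F) d e (λ rs → ∀ n → P n rs) σ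
      winI rs cs len len′ ∀p τ′ =
        subst id (sym (IWins-chooseII σ τ′ {F = F} rs cs (catchUp-now σ τ′ rs cs len)))
          (IWins-agreeI (choiceMade-persistent e c) (σ-agrees c) (F c) rs (cs ∷ʳ c)
            (choiceMade-∷ʳ rs cs c len′)
            (winningI (D c) rs (cs ∷ʳ c) len (length-∷ʳ-suc cs c len′) (∀p c) τ′))
        where c = choiceMove τ′ rs cs

      winII : WinningII (chooseII d F) d e (λ rs → ∀ n → P n rs) τ
      winII rs cs len len′ ¬∀p σ′ w =
        winningII (D c) rs (cs ∷ʳ c) len (length-∷ʳ-suc cs c len′) c-spec σ′
          (IWins-agreeII (choiceMade-persistent e c) (τ-agrees c) (F c) rs (cs ∷ʳ c)
            (choiceMade-∷ʳ rs cs c len′)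
            (subst id (IWins-chooseII σ′ τ {F = F} rs cs (catchUp-now σ′ τ rs cs len)) w))
        where
        c = choiceMove τ rs cs
        c-spec : ¬ P c rs
        c-spec = subst (λ m → ¬ P m rs) (sym (τ-chooses rs cs len′))
                   (ε-spec (λ n → ¬ P n rs) (proj₂ (¬∀⇒∃¬ ¬∀p)))

    afterRow-decides-∃ : ∀ {d e G P′} {Q : List Baire → Baire → Set} → Decides G (suc d) (suc e) P′ →
      (∀ rs r y → length rs ≡ d → (∀ j → r (double j) ≡ y j) → P′ (rs ∷ʳ r) ⇔ Q rs y) →
      Decides (afterRow d G) d e (λ rs → ∃ (Q rs))
    afterRow-decides-∃ {d} {e} {G} {P′} {Q} D P′⇔Q = record
      { strategyI = σ ; winningI = winI ; strategyII = strategyII D ; winningII = winII }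
      where
      σ : Strat²
      σ = rowThen d (λ rs _ → playing (ε (λ _ → 0) (Q rs))) (strategyI D)

      σ-agrees : AgreeOn (RowPlayed d) (strategyI D) σ
      σ-agrees = AgreeOn-sym rowThen-agrees

      σ-plays : ∀ rs cs → length rs ≡ d → rowMove σ rs cs ≡ playing (ε (λ _ → 0) (Q rs))
      σ-plays = rowThen-now {σ = strategyI D}

      winI : WinningI (afterRow d G) d e (λ rs → ∃ (Q rs)) σ
      winI rs cs len len′ (y , q) τ =
        subst id (sym (IWins-afterRow σ τ {G = G} rs cs len))
          (IWins-agreeI (rowPlayed-persistent d) σ-agrees G (rs ∷ʳ r) (cs ∷ʳ c) (rowPlayed-∷ʳ rs r cs len)
            (winningI D (rs ∷ʳ r) (cs ∷ʳ c) (length-∷ʳ-suc rs r len) (length-∷ʳ-suc cs c len′)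
              (Equivalence.from (P′⇔Q rs r _ len evens) (ε-spec (Q rs) q)) τ))
        where
        r = Run.nextRow σ τ rs cs
        c = choiceMove σ (rs ∷ʳ r) cs
        evens : ∀ j → r (double j) ≡ ε (λ _ → 0) (Q rs) j
        evens j = trans (cong (λ s → rowPlay s (rowMove τ rs cs) (double j)) (σ-plays rs cs len))
                        (rowPlay-even (ε (λ _ → 0) (Q rs)) (rowMove τ rs cs) j)

      winII : WinningII (afterRow d G) d e (λ rs → ∃ (Q rs)) (strategyII D)
      winII rs cs len len′ ∄ σ w =
        winningII D (rs ∷ʳ r) (cs ∷ʳ c) (length-∷ʳ-suc rs r len) (length-∷ʳ-suc cs c len′)
          (λ p′ → ∄ (_ , Equivalence.to (P′⇔Q rs r _ len λ _ → refl) p′)) σ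
          (subst id (IWins-afterRow σ (strategyII D) {G = G} rs cs len) w)
        where
        r = Run.nextRow σ (strategyII D) rs cs
        c = choiceMove σ (rs ∷ʳ r) cs

    afterRow-decides-∀ : ∀ {d e G P′} {Q : List Baire → Baire → Set} → Decides G (suc d) (suc e) P′ →
      (∀ rs r y → length rs ≡ d → (∀ j → r (suc (double j)) ≡ y j) → P′ (rs ∷ʳ r) ⇔ Q rs y) →
      Decides (afterRow d G) d e (λ rs → ∀ y → Q rs y)
    afterRow-decides-∀ {d} {e} {G} {P′} {Q} D P′⇔Q = record
      { strategyI = strategyI D ; winningI = winI ; strategyII = τ ; winningII = winII }
      where
      τ : Strat²
      τ = rowThen d (λ rs _ → playing (ε (λ _ → 0) (λ y → ¬ Q rs y))) (strategyII D)

      τ-plays : ∀ rs cs → length rs ≡ d → rowMove τ rs cs ≡ playing (ε (λ _ → 0) (λ y → ¬ Q rs y))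
      τ-plays = rowThen-now {σ = strategyII D}

      winI : WinningI (afterRow d G) d e (λ rs → ∀ y → Q rs y) (strategyI D)
      winI rs cs len len′ ∀q τ′ =
        subst id (sym (IWins-afterRow (strategyI D) τ′ {G = G} rs cs len))
          (winningI D (rs ∷ʳ r) (cs ∷ʳ c) (length-∷ʳ-suc rs r len) (length-∷ʳ-suc cs c len′)
            (Equivalence.from (P′⇔Q rs r _ len λ _ → refl) (∀q _)) τ′)
        where
        r = Run.nextRow (strategyI D) τ′ rs cs
        c = choiceMove (strategyI D) (rs ∷ʳ r) cs

      winII : WinningII (afterRow d G) d e (λ rs → ∀ y → Q rs y) τ
      winII rs cs len len′ ¬∀q σ w =
        winningII D (rs ∷ʳ r) (cs ∷ʳ c) (length-∷ʳ-suc rs r len) (length-∷ʳ-suc cs c len′)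
          (λ p′ → ε-spec (λ y → ¬ Q rs y) (proj₂ (¬∀⇒∃¬ ¬∀q)) (Equivalence.to (P′⇔Q rs r _ len odds) p′)) σ
          (IWins-agreeII (rowPlayed-persistent d) rowThen-agrees G (rs ∷ʳ r) (cs ∷ʳ c) (rowPlayed-∷ʳ rs r cs len)
            (subst id (IWins-afterRow σ τ {G = G} rs cs len) w))
        where
        r = Run.nextRow σ τ rs cs
        c = choiceMove σ (rs ∷ʳ r) cs
        odds : ∀ j → r (suc (double j)) ≡ ε (λ _ → 0) (λ y → ¬ Q rs y) j
        odds j = trans (cong (λ t → rowPlay (rowMove σ rs cs) t (suc (double j))) (τ-plays rs cs len))
                       (rowPlay-odd (ε (λ _ → 0) (λ y → ¬ Q rs y)) (rowMove σ rs cs) j)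

    afterRow-determined : ∀ {G P} → (∀ G → Determined² G) → Decides G 1 1 P →
      Determined (λ x → P (x ∷ []))
    afterRow-determined {G} {P} determined D with determined (afterRow 0 G)
    ... | inj₁ (σ , σ-wins) = inj₁ (rowMove σ [] [] , λ t → dne λ ¬p →
      let τ = rowThen 0 (λ _ _ → t) (strategyII D)
          r = Run.nextRow σ τ [] []
          c = choiceMove σ (r ∷ []) []
      in winningII D (r ∷ []) (c ∷ []) refl refl ¬p σ
           (IWins-agreeII (rowPlayed-persistent 0) rowThen-agrees G (r ∷ []) (c ∷ []) (r , refl)
             (subst id (IWins-afterRow σ τ {G = G} [] [] refl) (σ-wins τ))))
    ... | inj₂ (τ , τ-wins) = inj₂ (rowMove τ [] [] , λ s p →
      let σ = rowThen 0 (λ _ _ → s) (strategyI D)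
          r = Run.nextRow σ τ [] []
          c = choiceMove σ (r ∷ []) []
      in τ-wins σ (subst id (sym (IWins-afterRow σ τ {G = G} [] [] refl))
           (IWins-agreeI (rowPlayed-persistent 0) (AgreeOn-sym rowThen-agrees) G (r ∷ []) (c ∷ []) (r , refl)
             (winningI D (r ∷ []) (c ∷ []) refl refl p τ))))

    sigmaProj-deciders : ∀ {k d A} → SigmaProj k A → (Rd : Reader k d) (e : ℕ) →
      Decider d e (A ∘ readRows Rd) × Decider d e (¬_ ∘ A ∘ readRows Rd)
    sigmaProj-deciders {A = A} (open∈ A-open) Rd e =
        Decider-resp (λ {rs} → ⇔-sym (open⇔∃N rs))
          (_ , chooseI-decides λ m → base-decides (neighbourhood-clopen Rd A m))
      , Decider-resp (λ {rs} → ⇔-trans ∀¬⇔¬∃ (¬-cong-⇔ (⇔-sym (open⇔∃N rs))))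
          (_ , chooseII-decides λ m → base-decides (ClopenBelow-¬ (neighbourhood-clopen Rd A m)))
      where
      open⇔∃N : ∀ rs → A (readRows Rd rs) ⇔ ∃ λ m → Neighbourhood Rd A m (padRows rs)
      open⇔∃N rs = open⇔∃neighbourhood A-open Rd (padRows rs)
    sigmaProj-deciders (compl A-sp) Rd e =
      let G , H = sigmaProj-deciders A-sp Rd e in H , Decider-resp (mk⇔ (λ a ¬a → ¬a a) dne) G
    sigmaProj-deciders (union A-sp) Rd e =
        (_ , chooseI-decides λ n → proj₂ (proj₁ (below n)))
      , Decider-resp ∀¬⇔¬∃ (_ , chooseII-decides λ n → proj₂ (proj₂ (below n)))
      where below = λ n → sigmaProj-deciders (A-sp n) Rd (suc e)
    sigmaProj-deciders {k} {d} (proj i A-sp) Rd e =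
        (_ , afterRow-decides-∃ (proj₂ (proj₁ (sigmaProj-deciders A-sp evenReader (suc e))))
               (insertRow-⇔ A-sp Rd i double double double-mono))
      , Decider-resp ∀¬⇔¬∃
          (_ , afterRow-decides-∀ (proj₂ (proj₂ (sigmaProj-deciders A-sp oddReader (suc e))))
                 λ rs r y len odds → ¬-cong-⇔ (insertRow-⇔ A-sp Rd i _ _ 1+double-mono rs r y len odds))
      where
      evenReader oddReader : Reader (suc k) (suc d)
      evenReader = insertRow Rd i double double double-mono
      oddReader  = insertRow Rd i (suc ∘ double) double 1+double-mono
    sigmaProj-deciders (ext A-sp A⇔B) Rd e =
      let G , H = sigmaProj-deciders A-sp Rd e
      in Decider-resp (A⇔B _) G , Decider-resp (¬-cong-⇔ (A⇔B _)) H

open import Level using (suc; zero; Lift; lift; lower)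
open import Data.Product using (proj₁; proj₂)
open import Relation.Nullary using (Dec)
open import Relation.Nullary.Decidable using (map′)

proposition3p1 : ExcludedMiddle (suc zero) →
    (∀ (G : SimpleClopen) → Determined² G) →
    ∀ (A : Baire → Set) → SigmaProj 1 (λ x → A (x Fin.zero)) → Determined A
proposition3p1 em determined A A-sp =
  afterRow-determined lem determined (proj₂ (proj₁ (sigmaProj-deciders lem A-sp firstRow 1)))
  where
  lem : {P : Set} → Dec P
  lem {P} = map′ lower lift (em {Lift _ P})
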